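{- Let $m = p_1^{e_1}\cdots p_r^{e_r}$, $R = \{1,\ldots,r\}$, $U=(\mathbb{Z}/m\mathbb{Z})^\times$, let $I \subseteq K \subseteq R$, and let $H: d_IU\to d_KU$ be the map $H(d_Iu) = d_{K\setminus I}d_I u = d_K u$. Then for every $u\in U$, $$H^{ -1}(d_K u) = \{d_I v \,:\, v \in U,\ v\equiv u \pmod{m/g_K}\},$$ and $H$ is a $\frac{\phi(g_K)}{\phi(g_I)}$-to-$1$ map.
   Context: $m = p_1^{e_1}\cdots p_r^{e_r}$ with distinct primes, $e_i\ge1$; $\phi$ is Euler's totient function. For $J\subseteq R$: $g_J=\prod_{i\in J}p_i^{e_i}$ ($g_\emptyset=1$), $d_J$ is the idempotent of $\mathbb{Z}/m\mathbb{Z}$ with $d_J\equiv 0\pmod{p_i^{e_i}}$ for $i\in J$ and $d_J\equiv1\pmod{p_j^{e_j}}$ for $j\notin J$, and $d_JU=\{d_Ju: u\in U\}$. -}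

module Defs where

open import Data.Nat using (ℕ; zero; suc; _*_; _^_; _<_; _≤_; ∣_-_∣)
open import Data.Nat.Divisibility using (_∣_; _∣?_)
open import Data.Nat.Coprimality using (Coprime; coprime?)
open import Data.Nat.Primality using (Prime)
open import Data.Bool using (Bool; true; false; if_then_else_)
open import Data.Fin using (Fin; toℕ) renaming (zero to fzero; suc to fsuc)
open import Data.Fin.Subset using (Subset; _∈_; _∉_)
open import Data.Vec using (lookup)
open import Data.List using (List; length; filter)
open import Data.List.Base using (allFin)
open import Data.Product using (∃; _×_; _,_)
open import Data.Fin.Properties using (any?)
open import Relation.Nullary using (Dec)
open import Relation.Nullary.Decidable using (_×-dec_)
open import Function using (_∘_)
open import Relation.Binary.PropositionalEquality using (_≡_)

∏ : ∀ {n} → (Fin n → ℕ) → ℕ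
∏ {zero}  f = 1
∏ {suc n} f = f fzero * ∏ (f ∘ fsuc)

modulus : ∀ {r} → (Fin r → ℕ) → (Fin r → ℕ) → ℕ
modulus p e = ∏ (λ i → p i ^ e i)

gJ : ∀ {r} → (Fin r → ℕ) → (Fin r → ℕ) → Subset r → ℕ
gJ p e J = ∏ (λ i → if lookup J i then p i ^ e i else 1)

Cong : ℕ → ℕ → ℕ → Set
Cong n a b = n ∣ ∣ a - b ∣

cong? : ∀ n a b → Dec (Cong n a b)
cong? n a b = n ∣? ∣ a - b ∣

φ : ℕ → ℕ
φ n = length (filter (λ (k : Fin n) → coprime? (toℕ k) n) (allFin n))

Factorisation : ∀ {r} → (Fin r → ℕ) → (Fin r → ℕ) → Set
Factorisation p e = (∀ i → Prime (p i)) × (∀ i j → p i ≡ p j → i ≡ j) × (∀ i → 1 ≤ e i)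

-- d J (a natural number in [0,m)) is the idempotent d_J of ℤ/mℤ:
-- d_J ≡ 0 mod p_i^e_i for i ∈ J, d_J ≡ 1 mod p_j^e_j for j ∉ J
IsIdempotentFamily : ∀ {r} → (Fin r → ℕ) → (Fin r → ℕ) → (Subset r → ℕ) → Set
IsIdempotentFamily p e d = ∀ J →
  (d J < modulus p e)
  × (∀ i → i ∈ J → Cong (p i ^ e i) (d J) 0)
  × (∀ i → i ∉ J → Cong (p i ^ e i) (d J) 1)

-- x ∈ c·U  (residues mod m, U = units of ℤ/mℤ represented in [0,m))
InDU : (m c x : ℕ) → Set
InDU m c x = ∃ λ (u : Fin m) → Coprime (toℕ u) m × Cong m x (c * toℕ u)

inDU? : ∀ m c x → Dec (InDU m c x)
inDU? m c x = any? (λ u → coprime? (toℕ u) m ×-dec cong? m x (c * toℕ u))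

-- the fibre over y of the map x ↦ h·x (mod m) restricted to c·U
InFibre : (m c h y : ℕ) → Fin m → Set
InFibre m c h y x = InDU m c (toℕ x) × Cong m (h * toℕ x) y

inFibre? : ∀ m c h y (x : Fin m) → Dec (InFibre m c h y x)
inFibre? m c h y x = inDU? m c (toℕ x) ×-dec cong? m (h * toℕ x) y

fibreSize : (m c h y : ℕ) → ℕ
fibreSize m c h y = length (filter (inFibre? m c h y) (allFin m))

module Submission where

-- By the Chinese remainder theorem ℤ/mℤ ≅ ∏_i ℤ/p_i^{e_i}ℤ, and the idempotent d_J
-- has residue 0 at the components i ∈ J and 1 at all others.  So at a component
-- everything depends only on the role of i relative to I ⊆ K: i ∈ I, i ∈ K ∖ I,
-- or i ∉ K.  Both the fibre H⁻¹(d_K u) and the set {d_I v : v ∈ U, v ≡ u mod m/g_K}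
-- consist exactly of the x whose residue at every component has the "local shape"
-- of its role (x ≡ 0, x a unit, x ≡ u respectively); this describes the fibre.
-- Counting points of local shape componentwise gives 1, φ(p_i^{e_i}), 1, and with
-- the multiplicativity of φ this yields |fibre| · φ(g_I) = φ(g_K).

open import Defs
open import Data.Nat using (ℕ; _*_)
open import Data.Nat.Coprimality using (Coprime)
open import Data.Fin using (Fin; toℕ)
open import Data.Fin.Subset using (Subset; _⊆_; _─_; ∁)
open import Data.Product using (∃; _×_)
open import Function.Bundles using (_⇔_)
open import Relation.Binary.PropositionalEquality using (_≡_)

open import Data.Nat using (zero; suc; _+_; _∸_; _^_; _<_; _≤_; z≤n; s≤s; NonZero; nonTrivial⇒≢1; _≟_; ∣_-_∣)
open import Data.Nat.Properties
open import Data.Nat.DivMod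
open import Data.Nat.Divisibility
open import Data.Nat.Coprimality using (coprime?; coprime⇒gcd≡1; coprime-Bézout; coprime-factors; 1-coprimeTo)
  renaming (sym to coprime-sym)
open import Data.Nat.GCD using (module Bézout)
open import Data.Nat.LCM using (lcm; lcm-least; gcd*lcm)
open import Data.Nat.Primality using (Prime; prime⇒irreducible; prime⇒nonTrivial; prime⇒nonZero)
open import Data.Nat.Tactic.RingSolver using (solve-∀)
open import Data.Fin using (fromℕ<) renaming (zero to fzero; suc to fsuc)
open import Data.Fin.Properties using (toℕ-fromℕ<) renaming (suc-injective to fsuc-injective)
open import Data.Fin.Subset using (_∉_)
open import Data.Vec using (lookup; _∷_)
open import Data.Vec.Properties using (lookup⇒[]=; []=⇒lookup; lookup-map)
open import Data.Bool using (Bool; true; false; if_then_else_; not)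
open import Data.List using (length; filter; tabulate)
open import Data.Product using (_,_; proj₁; proj₂)
open import Data.Sum using (inj₁; inj₂)
open import Data.Empty using (⊥-elim)
open import Relation.Binary.PropositionalEquality
  using (_≢_; refl; sym; trans; cong; cong₂; subst; subst₂; module ≡-Reasoning)
open import Relation.Nullary using (Dec; does; yes; no; ¬_)
open import Relation.Nullary.Decidable using (dec-true; dec-false)
open import Relation.Unary using (Decidable)
open import Function using (_∘_; id)
open import Function.Bundles using (mk⇔; Equivalence)

-- Residues.  Defs.Cong n a b says n ∣ |a - b|; for n ≠ 0 this is
-- equality of remainders a % n ≡ b % n, the form used for computation.

-- equal remainders: a - b is a multiple of n, namely of |a/n - b/n|
%≡⇒Cong : ∀ n a b .{{_ : NonZero n}} → a % n ≡ b % n → Cong n a b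
%≡⇒Cong n a b eq = divides ∣ a / n - b / n ∣ (begin
    ∣ a - b ∣                                          ≡⟨ cong₂ ∣_-_∣ (m≡m%n+[m/n]*n a n) (m≡m%n+[m/n]*n b n) ⟩
    ∣ a % n + a / n * n - b % n + b / n * n ∣          ≡⟨ cong (λ r → ∣ r + a / n * n - b % n + b / n * n ∣) eq ⟩
    ∣ b % n + a / n * n - b % n + b / n * n ∣          ≡⟨ ∣m+n-m+o∣≡∣n-o∣ (b % n) (a / n * n) (b / n * n) ⟩
    ∣ a / n * n - b / n * n ∣                          ≡⟨ *-distribʳ-∣-∣ n (a / n) (b / n) ⟨
    ∣ a / n - b / n ∣ * n                              ∎)
  where open ≡-Reasoning

private
  Cong⇒%≡-ordered : ∀ n {a b} .{{_ : NonZero n}} → a ≤ b → Cong n a b → a % n ≡ b % n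
  Cong⇒%≡-ordered n {a} {b} a≤b n∣a-b = begin
    a % n             ≡⟨ %-remove-+ʳ a (subst (n ∣_) (m≤n⇒∣m-n∣≡n∸m a≤b) n∣a-b) ⟨
    (a + (b ∸ a)) % n ≡⟨ cong (_% n) (m+[n∸m]≡n a≤b) ⟩
    b % n             ∎
    where open ≡-Reasoning

Cong⇒%≡ : ∀ n a b .{{_ : NonZero n}} → Cong n a b → a % n ≡ b % n
Cong⇒%≡ n a b n∣a-b with ≤-total a b
... | inj₁ a≤b = Cong⇒%≡-ordered n a≤b n∣a-b
... | inj₂ b≤a = sym (Cong⇒%≡-ordered n b≤a (subst (n ∣_) (∣-∣-comm a b) n∣a-b))

%-+-cong : ∀ n {a b c d} .{{_ : NonZero n}} → a % n ≡ b % n → c % n ≡ d % n → (a + c) % n ≡ (b + d) % n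
%-+-cong n {a} {b} {c} {d} a≈b c≈d = begin
  (a + c) % n             ≡⟨ %-distribˡ-+ a c n ⟩
  (a % n + c % n) % n     ≡⟨ cong₂ (λ x y → (x + y) % n) a≈b c≈d ⟩
  (b % n + d % n) % n     ≡⟨ %-distribˡ-+ b d n ⟨
  (b + d) % n             ∎
  where open ≡-Reasoning

%-*-cong : ∀ n {a b c d} .{{_ : NonZero n}} → a % n ≡ b % n → c % n ≡ d % n → (a * c) % n ≡ (b * d) % n
%-*-cong n {a} {b} {c} {d} a≈b c≈d = begin
  (a * c) % n             ≡⟨ %-distribˡ-* a c n ⟩
  (a % n * (c % n)) % n   ≡⟨ cong₂ (λ x y → (x * y) % n) a≈b c≈d ⟩
  (b % n * (d % n)) % n   ≡⟨ %-distribˡ-* b d n ⟨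
  (b * d) % n             ∎
  where open ≡-Reasoning

%-divisor : ∀ n N {a b} .{{_ : NonZero n}} .{{_ : NonZero N}} → n ∣ N → a % N ≡ b % N → a % n ≡ b % n
%-divisor n N {a} {b} n∣N a≈b =
  trans (sym (m∣n⇒o%n%m≡o%m n N a n∣N)) (trans (cong (_% n) a≈b) (m∣n⇒o%n%m≡o%m n N b n∣N))

-- Multiplying by a residue 0 or 1; the idempotents d_J have only these residues.

%-*-by-0 : ∀ n {d c} .{{_ : NonZero n}} → d % n ≡ 0 % n → (d * c) % n ≡ 0 % n
%-*-by-0 n {d} {c} d≈0 = %-*-cong n {d} {0} {c} {c} d≈0 refl

%-*-by-1 : ∀ n {d c} .{{_ : NonZero n}} → d % n ≡ 1 % n → (d * c) % n ≡ c % n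
%-*-by-1 n {d} {c} d≈1 = trans (%-*-cong n {d} {1} {c} {c} d≈1 refl) (cong (_% n) (*-identityˡ c))

coprime-1ʳ : ∀ a → Coprime a 1
coprime-1ʳ a = coprime-sym (1-coprimeTo a)

coprime-*ʳ : ∀ {a b c} → Coprime a b → Coprime a c → Coprime a (b * c)
coprime-*ʳ {a} {b} {c} a⊥b a⊥c (d∣a , d∣bc) = a⊥c (d∣a , coprime-factors a⊥b (∣m⇒∣m*n c d∣a , d∣bc))

coprime-^ʳ : ∀ {a b} k → Coprime a b → Coprime a (b ^ k)
coprime-^ʳ {a} zero    a⊥b = coprime-1ʳ a
coprime-^ʳ     (suc k) a⊥b = coprime-*ʳ a⊥b (coprime-^ʳ k a⊥b)

coprime-^ : ∀ {a b} k l → Coprime a b → Coprime (a ^ k) (b ^ l)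
coprime-^ k l a⊥b = coprime-sym (coprime-^ʳ k (coprime-sym (coprime-^ʳ l a⊥b)))

coprime-divisorʳ : ∀ {x a b} → Coprime x a → b ∣ a → Coprime x b
coprime-divisorʳ x⊥a b∣a (d∣x , d∣b) = x⊥a (d∣x , ∣-trans d∣b b∣a)

coprime-% : ∀ {x y n} .{{_ : NonZero n}} → x % n ≡ y % n → Coprime x n → Coprime y n
coprime-% {x} {y} {n} x≈y x⊥n (d∣y , d∣n) =
  x⊥n (∣n∣m%n⇒∣m d∣n (subst (_ ∣_) (sym x≈y) (%-presˡ-∣ d∣y d∣n)) , d∣n)

-- Coprime divisors of c divide c jointly (their lcm is their product).
coprime-∣⇒*∣ : ∀ {a b c} → Coprime a b → a ∣ c → b ∣ c → a * b ∣ c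
coprime-∣⇒*∣ {a} {b} a⊥b a∣c b∣c = subst (_∣ _) lcm≡a*b (lcm-least a∣c b∣c)
  where
  lcm≡a*b : lcm a b ≡ a * b
  lcm≡a*b = trans (sym (*-identityˡ (lcm a b)))
                  (trans (cong (_* lcm a b) (sym (coprime⇒gcd≡1 a⊥b))) (gcd*lcm a b))

distinct-primes-coprime : ∀ {a b} → Prime a → Prime b → a ≢ b → Coprime a b
distinct-primes-coprime pa pb a≢b (d∣a , d∣b) with prime⇒irreducible pa d∣a
... | inj₁ d≡1 = d≡1
... | inj₂ refl with prime⇒irreducible pb d∣b
...   | inj₁ a≡1 = ⊥-elim (nonTrivial⇒≢1 {{prime⇒nonTrivial pa}} a≡1)
...   | inj₂ a≡b = ⊥-elim (a≢b a≡b)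

S : ℕ → (ℕ → ℕ) → ℕ
S zero    f = 0
S (suc n) f = f 0 + S n (f ∘ suc)

S-cong : ∀ n {f g} → (∀ k → k < n → f k ≡ g k) → S n f ≡ S n g
S-cong zero    f≡g = refl
S-cong (suc n) f≡g = cong₂ _+_ (f≡g 0 (s≤s z≤n)) (S-cong n (λ k k<n → f≡g (suc k) (s≤s k<n)))

S-zero : ∀ n → S n (λ _ → 0) ≡ 0
S-zero zero    = refl
S-zero (suc n) = S-zero n

S-+ : ∀ n (f g : ℕ → ℕ) → S n (λ k → f k + g k) ≡ S n f + S n g
S-+ zero    f g = refl
S-+ (suc n) f g = trans (cong (f 0 + g 0 +_) (S-+ n (f ∘ suc) (g ∘ suc)))
                        (interchange (f 0) (g 0) (S n (f ∘ suc)) (S n (g ∘ suc)))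
  where
  interchange : ∀ a b c d → a + b + (c + d) ≡ a + c + (b + d)
  interchange = solve-∀

S-*ˡ : ∀ n c (f : ℕ → ℕ) → S n (λ k → c * f k) ≡ c * S n f
S-*ˡ zero    c f = sym (*-zeroʳ c)
S-*ˡ (suc n) c f = trans (cong (c * f 0 +_) (S-*ˡ n c (f ∘ suc))) (sym (*-distribˡ-+ c (f 0) _))

S-*ʳ : ∀ n c (f : ℕ → ℕ) → S n (λ k → f k * c) ≡ S n f * c
S-*ʳ n c f = trans (S-cong n (λ k _ → *-comm (f k) c)) (trans (S-*ˡ n c f) (*-comm c (S n f)))

S-swap : ∀ n m (F : ℕ → ℕ → ℕ) → S n (λ x → S m (F x)) ≡ S m (λ y → S n (λ x → F x y))
S-swap zero    m F = sym (S-zero m)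
S-swap (suc n) m F = trans (cong (S m (F 0) +_) (S-swap n m (F ∘ suc)))
                           (sym (S-+ m (F 0) (λ y → S n (λ x → F (suc x) y))))

ind : ∀ {P : Set} → Dec P → ℕ
ind P? = if does P? then 1 else 0

ind-yes : ∀ {P : Set} (P? : Dec P) → P → ind P? ≡ 1
ind-yes P? p = cong (if_then 1 else 0) (dec-true P? p)

ind-no : ∀ {P : Set} (P? : Dec P) → ¬ P → ind P? ≡ 0
ind-no P? ¬p = cong (if_then 1 else 0) (dec-false P? ¬p)

length-filter : ∀ {A : Set} {P : A → Set} (P? : Decidable P) {n} (g : Fin n → A) (h : ℕ → ℕ) →
                (∀ k → ind (P? (g k)) ≡ h (toℕ k)) → length (filter P? (tabulate g)) ≡ S n h
length-filter P? {zero}  g h ind≡h = refl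
length-filter P? {suc n} g h ind≡h with P? (g fzero) | ind≡h fzero
... | yes _ | 1≡h0 = cong₂ _+_ 1≡h0 (length-filter P? (g ∘ fsuc) (h ∘ suc) (ind≡h ∘ fsuc))
... | no _  | 0≡h0 = cong₂ _+_ 0≡h0 (length-filter P? (g ∘ fsuc) (h ∘ suc) (ind≡h ∘ fsuc))

δ : ℕ → ℕ → ℕ
δ i y = ind (i ≟ y)

S-δ : ∀ n y (h : ℕ → ℕ) → y < n → S n (λ i → δ i y * h i) ≡ h y
S-δ (suc n) zero    h _         = trans (cong₂ _+_ (+-identityʳ (h 0)) (S-zero n)) (+-identityʳ (h 0))
S-δ (suc n) (suc y) h (s≤s y<n) = S-δ n y (h ∘ suc) y<n

count-residue : ∀ q t .{{_ : NonZero q}} → t < q → S q (λ y → ind (y % q ≟ t)) ≡ 1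
count-residue q t t<q = trans (S-cong q pointwise) (S-δ q t (λ _ → 1) t<q)
  where
  pointwise : ∀ y → y < q → ind (y % q ≟ t) ≡ δ y t * 1
  pointwise y y<q rewrite m<n⇒m%n≡m y<q = sym (*-identityʳ (δ y t))

-- Chinese remainder theorem for two coprime moduli: every pair of residues
-- is attained (via an idempotent built from a Bézout identity), uniquely
-- below a·b; hence summing over x < a·b is summing over pairs of residues.

private
  -- For e ≡ 0 (mod a) and e ≡ 1 (mod b), z = i + e·(k + (b-1)·i) solves z ≡ i (mod a), z ≡ k (mod b).
  solve-by-idempotent : ∀ a b .{{_ : NonZero a}} .{{_ : NonZero b}} e → e % a ≡ 0 → e % b ≡ 1 % b →
                        ∀ i k → ∃ λ z → z % a ≡ i % a × z % b ≡ k % b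
  solve-by-idempotent a b@(suc b-1) e e≈0 e≈1 i k = i + e * c , ≈i , ≈k
    where
    c = k + b-1 * i
    ≈i : (i + e * c) % a ≡ i % a
    ≈i = %-remove-+ʳ i (∣m⇒∣m*n c (m%n≡0⇒n∣m e a e≈0))
    rearrange : ∀ i k b-1 → i + (k + b-1 * i) ≡ k + i * suc b-1
    rearrange = solve-∀
    ≈k : (i + e * c) % b ≡ k % b
    ≈k = begin
      (i + e * c) % b  ≡⟨ %-+-cong b {i} {i} refl (%-*-by-1 b {e} {c} e≈1) ⟩
      (i + c) % b      ≡⟨ cong (_% b) (rearrange i k b-1) ⟩
      (k + i * b) % b  ≡⟨ [m+kn]%n≡m%n k i b ⟩
      k % b            ∎
      where open ≡-Reasoning

module _ (a b : ℕ) .{{_ : NonZero a}} .{{_ : NonZero b}} (a⊥b : Coprime a b) where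
  private
    instance
      ab-nonZero : NonZero (a * b)
      ab-nonZero = m*n≢0 a b

  crt-exists : ∀ i k → ∃ λ z → z % a ≡ i % a × z % b ≡ k % b
  crt-exists i k with coprime-Bézout a⊥b
  ... | Bézout.+- x y 1+yb≡xa = solve-by-idempotent a b (x * a) (m*n%n≡0 x a)
          (trans (cong (_% b) (sym 1+yb≡xa)) ([m+kn]%n≡m%n 1 y b)) i k
  ... | Bézout.-+ x y 1+xa≡yb with solve-by-idempotent b a (y * b) (m*n%n≡0 y b)
          (trans (cong (_% a) (sym 1+xa≡yb)) ([m+kn]%n≡m%n 1 x a)) k i
  ...   | z , ≈k , ≈i = z , ≈i , ≈k

  crt-unique : ∀ x y → x < a * b → y < a * b → x % a ≡ y % a → x % b ≡ y % b → x ≡ y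
  crt-unique x y x<ab y<ab x≈y[a] x≈y[b] = begin
    x             ≡⟨ m<n⇒m%n≡m x<ab ⟨
    x % (a * b)   ≡⟨ Cong⇒%≡ (a * b) x y ab∣x-y ⟩
    y % (a * b)   ≡⟨ m<n⇒m%n≡m y<ab ⟩
    y             ∎
    where
    open ≡-Reasoning
    ab∣x-y : Cong (a * b) x y
    ab∣x-y = coprime-∣⇒*∣ a⊥b (%≡⇒Cong a x y x≈y[a]) (%≡⇒Cong b x y x≈y[b])

  crt-count : ∀ i k → i < a → k < b → S (a * b) (λ x → δ i (x % a) * δ k (x % b)) ≡ 1
  crt-count i k i<a k<b = trans (S-cong (a * b) pointwise) (S-δ (a * b) x₀ (λ _ → 1) (m%n<n z (a * b)))
    where
    z = proj₁ (crt-exists i k)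
    x₀ = z % (a * b)
    x₀≈i : x₀ % a ≡ i
    x₀≈i = trans (m∣n⇒o%n%m≡o%m a (a * b) z (m∣m*n b)) (trans (proj₁ (proj₂ (crt-exists i k))) (m<n⇒m%n≡m i<a))
    x₀≈k : x₀ % b ≡ k
    x₀≈k = trans (m∣n⇒o%n%m≡o%m b (a * b) z (n∣m*n a)) (trans (proj₂ (proj₂ (crt-exists i k))) (m<n⇒m%n≡m k<b))
    away : ∀ {x} → x ≢ x₀ → 0 ≡ δ x x₀ * 1
    away {x} x≢x₀ = cong (_* 1) (sym (ind-no (x ≟ x₀) x≢x₀))
    pointwise : ∀ x → x < a * b → δ i (x % a) * δ k (x % b) ≡ δ x x₀ * 1
    pointwise x x<ab with i ≟ x % a | k ≟ x % b
    ... | yes i≡ | yes k≡ = trans (cong₂ _*_ (ind-yes (i ≟ x % a) i≡) (ind-yes (k ≟ x % b) k≡))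
                                  (cong (_* 1) (sym (ind-yes (x ≟ x₀) x≡x₀)))
      where
      x≡x₀ : x ≡ x₀
      x≡x₀ = crt-unique x x₀ x<ab (m%n<n z (a * b)) (trans (sym i≡) (sym x₀≈i)) (trans (sym k≡) (sym x₀≈k))
    ... | no i≢ | _      = trans (cong (_* δ k (x % b)) (ind-no (i ≟ x % a) i≢))
                                 (away (λ x≡x₀ → i≢ (sym (trans (cong (_% a) x≡x₀) x₀≈i))))
    ... | yes _ | no k≢  = trans (cong (δ i (x % a) *_) (ind-no (k ≟ x % b) k≢))
                                 (trans (*-zeroʳ (δ i (x % a)))
                                        (away (λ x≡x₀ → k≢ (sym (trans (cong (_% b) x≡x₀) x₀≈k)))))

  crt-reindex : ∀ (F : ℕ → ℕ → ℕ) → S (a * b) (λ x → F (x % a) (x % b)) ≡ S a (λ i → S b (F i))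
  crt-reindex F = begin
    S (a * b) (λ x → F (x % a) (x % b))
      ≡⟨ S-cong (a * b) (λ x _ → sift x) ⟩
    S (a * b) (λ x → S a (λ i → S b (λ k → δ i (x % a) * δ k (x % b) * F i k)))
      ≡⟨ S-swap (a * b) a _ ⟩
    S a (λ i → S (a * b) (λ x → S b (λ k → δ i (x % a) * δ k (x % b) * F i k)))
      ≡⟨ S-cong a (λ i _ → S-swap (a * b) b _) ⟩
    S a (λ i → S b (λ k → S (a * b) (λ x → δ i (x % a) * δ k (x % b) * F i k)))
      ≡⟨ S-cong a (λ i i<a → S-cong b (λ k k<b → count-out i k i<a k<b)) ⟩
    S a (λ i → S b (F i))  ∎
    where
    open ≡-Reasoning
    sift : ∀ x → F (x % a) (x % b) ≡ S a (λ i → S b (λ k → δ i (x % a) * δ k (x % b) * F i k))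
    sift x = begin
      F (x % a) (x % b)
        ≡⟨ S-δ a (x % a) (λ i → F i (x % b)) (m%n<n x a) ⟨
      S a (λ i → δ i (x % a) * F i (x % b))
        ≡⟨ S-cong a (λ i _ → cong (δ i (x % a) *_) (S-δ b (x % b) (F i) (m%n<n x b))) ⟨
      S a (λ i → δ i (x % a) * S b (λ k → δ k (x % b) * F i k))
        ≡⟨ S-cong a (λ i _ → S-*ˡ b (δ i (x % a)) _) ⟨
      S a (λ i → S b (λ k → δ i (x % a) * (δ k (x % b) * F i k)))
        ≡⟨ S-cong a (λ i _ → S-cong b (λ k _ → *-assoc (δ i (x % a)) (δ k (x % b)) (F i k))) ⟨
      S a (λ i → S b (λ k → δ i (x % a) * δ k (x % b) * F i k))  ∎
    -- each pair (i, k) is attained once, so its weight F i k is counted once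
    count-out : ∀ i k → i < a → k < b → S (a * b) (λ x → δ i (x % a) * δ k (x % b) * F i k) ≡ F i k
    count-out i k i<a k<b = begin
      S (a * b) (λ x → δ i (x % a) * δ k (x % b) * F i k)  ≡⟨ S-*ʳ (a * b) (F i k) _ ⟩
      S (a * b) (λ x → δ i (x % a) * δ k (x % b)) * F i k  ≡⟨ cong (_* F i k) (crt-count i k i<a k<b) ⟩
      1 * F i k                                             ≡⟨ *-identityˡ (F i k) ⟩
      F i k                                                 ∎

∏-cong : ∀ {r} {f g : Fin r → ℕ} → (∀ i → f i ≡ g i) → ∏ f ≡ ∏ g
∏-cong {zero}  f≡g = refl
∏-cong {suc r} f≡g = cong₂ _*_ (f≡g fzero) (∏-cong (f≡g ∘ fsuc))

∏-distrib : ∀ {r} (f g : Fin r → ℕ) → ∏ (λ i → f i * g i) ≡ ∏ f * ∏ g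
∏-distrib {zero}  f g = refl
∏-distrib {suc r} f g = trans (cong (f fzero * g fzero *_) (∏-distrib (f ∘ fsuc) (g ∘ fsuc)))
                              (interchange (f fzero) (g fzero) (∏ (f ∘ fsuc)) (∏ (g ∘ fsuc)))
  where
  interchange : ∀ a b c d → a * b * (c * d) ≡ a * c * (b * d)
  interchange = solve-∀

∏-nonZero : ∀ {r} (n : Fin r → ℕ) .{{_ : ∀ {i} → NonZero (n i)}} → NonZero (∏ n)
∏-nonZero {zero}  n = _
∏-nonZero {suc r} n = m*n≢0 (n fzero) (∏ (n ∘ fsuc))
  where instance
    tail-nonZero : NonZero (∏ (n ∘ fsuc))
    tail-nonZero = ∏-nonZero (n ∘ fsuc)

∣∏ : ∀ {r} (n : Fin r → ℕ) i → n i ∣ ∏ n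
∣∏ n fzero    = m∣m*n _
∣∏ n (fsuc i) = ∣n⇒∣m*n (n fzero) (∣∏ (n ∘ fsuc) i)

coprime-∏ʳ : ∀ {r} a (n : Fin r → ℕ) → (∀ i → Coprime a (n i)) → Coprime a (∏ n)
coprime-∏ʳ {zero}  a n a⊥n = coprime-1ʳ a
coprime-∏ʳ {suc r} a n a⊥n = coprime-*ʳ (a⊥n fzero) (coprime-∏ʳ a (n ∘ fsuc) (a⊥n ∘ fsuc))

PairwiseCoprime : ∀ {r} → (Fin r → ℕ) → Set
PairwiseCoprime n = ∀ i j → i ≢ j → Coprime (n i) (n j)

pairwise-tail : ∀ {r} (n : Fin (suc r) → ℕ) → PairwiseCoprime n → PairwiseCoprime (n ∘ fsuc)
pairwise-tail n n-pairwise i j i≢j = n-pairwise (fsuc i) (fsuc j) (i≢j ∘ fsuc-injective)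

head⊥tail : ∀ {r} (n : Fin (suc r) → ℕ) → PairwiseCoprime n → Coprime (n fzero) (∏ (n ∘ fsuc))
head⊥tail n n-pairwise = coprime-∏ʳ (n fzero) (n ∘ fsuc) (λ i → n-pairwise fzero (fsuc i) λ ())

∏∣ : ∀ {r} (n : Fin r → ℕ) → PairwiseCoprime n → ∀ {c} → (∀ i → n i ∣ c) → ∏ n ∣ c
∏∣ {zero}  n n-pairwise n∣c = 1∣ _
∏∣ {suc r} n n-pairwise n∣c =
  coprime-∣⇒*∣ (head⊥tail n n-pairwise) (n∣c fzero) (∏∣ (n ∘ fsuc) (pairwise-tail n n-pairwise) (n∣c ∘ fsuc))

Cong-∏⇒ : ∀ {r} (n : Fin r → ℕ) .{{_ : ∀ {i} → NonZero (n i)}} {a b} →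
          Cong (∏ n) a b → ∀ i → a % n i ≡ b % n i
Cong-∏⇒ n {a} {b} a≡b i = Cong⇒%≡ (n i) a b (∣-trans (∣∏ n i) a≡b)

Cong-∏⇐ : ∀ {r} (n : Fin r → ℕ) .{{_ : ∀ {i} → NonZero (n i)}} → PairwiseCoprime n →
          ∀ {a b} → (∀ i → a % n i ≡ b % n i) → Cong (∏ n) a b
Cong-∏⇐ n n-pairwise {a} {b} a≈b = ∏∣ n n-pairwise (λ i → %≡⇒Cong (n i) a b (a≈b i))

crt-exists-∏ : ∀ {r} (n : Fin r → ℕ) .{{_ : ∀ {i} → NonZero (n i)}} → PairwiseCoprime n →
               (c : Fin r → ℕ) → ∃ λ y → ∀ i → y % n i ≡ c i % n i
crt-exists-∏ {zero}  n n-pairwise c = 0 , λ ()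
crt-exists-∏ {suc r} n n-pairwise c = y , solves
  where
  instance
    tail-nonZero : NonZero (∏ (n ∘ fsuc))
    tail-nonZero = ∏-nonZero (n ∘ fsuc)
  tail-solution = crt-exists-∏ (n ∘ fsuc) (pairwise-tail n n-pairwise) (c ∘ fsuc)
  glued = crt-exists (n fzero) (∏ (n ∘ fsuc)) (head⊥tail n n-pairwise) (c fzero) (proj₁ tail-solution)
  y = proj₁ glued
  solves : ∀ i → y % n i ≡ c i % n i
  solves fzero    = proj₁ (proj₂ glued)
  solves (fsuc i) = trans (%-divisor (n (fsuc i)) (∏ (n ∘ fsuc)) (∣∏ (n ∘ fsuc) i) (proj₂ (proj₂ glued)))
                          (proj₂ tail-solution i)

crt-reindex-∏ : ∀ {r} (n : Fin r → ℕ) .{{_ : ∀ {i} → NonZero (n i)}} → PairwiseCoprime n →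
                (f : Fin r → ℕ → ℕ) → S (∏ n) (λ x → ∏ (λ i → f i (x % n i))) ≡ ∏ (λ i → S (n i) (f i))
crt-reindex-∏ {zero}  n n-pairwise f = refl
crt-reindex-∏ {suc r} n n-pairwise f = begin
    S (n₀ * N) (λ x → f fzero (x % n₀) * ∏ (λ j → f (fsuc j) (x % n (fsuc j))))
      ≡⟨ S-cong (n₀ * N) (λ x _ → cong (f fzero (x % n₀) *_) (∏-cong (λ j →
           cong (f (fsuc j)) (sym (m∣n⇒o%n%m≡o%m (n (fsuc j)) N x (∣∏ (n ∘ fsuc) j)))))) ⟩
    S (n₀ * N) (λ x → f fzero (x % n₀) * G (x % N))
      ≡⟨ crt-reindex n₀ N (head⊥tail n n-pairwise) (λ i k → f fzero i * G k) ⟩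
    S n₀ (λ i → S N (λ k → f fzero i * G k))
      ≡⟨ S-cong n₀ (λ i _ → S-*ˡ N (f fzero i) G) ⟩
    S n₀ (λ i → f fzero i * S N G)
      ≡⟨ S-*ʳ n₀ (S N G) (f fzero) ⟩
    S n₀ (f fzero) * S N G
      ≡⟨ cong (S n₀ (f fzero) *_) (crt-reindex-∏ (n ∘ fsuc) (pairwise-tail n n-pairwise) (f ∘ fsuc)) ⟩
    S n₀ (f fzero) * ∏ (λ j → S (n (fsuc j)) (f (fsuc j)))  ∎
  where
  open ≡-Reasoning
  n₀ = n fzero
  N = ∏ (n ∘ fsuc)
  instance
    tail-nonZero : NonZero N
    tail-nonZero = ∏-nonZero (n ∘ fsuc)
  G : ℕ → ℕ
  G y = ∏ (λ j → f (fsuc j) (y % n (fsuc j)))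

ind-∀ : ∀ {r} {P : Set} {Q : Fin r → Set} (P? : Dec P) (Q? : ∀ i → Dec (Q i)) →
        (P ⇔ (∀ i → Q i)) → ind P? ≡ ∏ (λ i → ind (Q? i))
ind-∀ {zero}  P? Q? P⇔∀Q = ind-yes P? (Equivalence.from P⇔∀Q (λ ()))
ind-∀ {suc r} P? Q? P⇔∀Q with Q? fzero
... | yes q₀ = trans (ind-∀ P? (Q? ∘ fsuc) P⇔∀Qsuc) (sym (+-identityʳ _))
  where
  P⇔∀Qsuc : _ ⇔ (∀ i → _)
  P⇔∀Qsuc = mk⇔ (λ p i → Equivalence.to P⇔∀Q p (fsuc i))
                (λ q → Equivalence.from P⇔∀Q λ { fzero → q₀ ; (fsuc i) → q i })
... | no ¬q₀ = ind-no P? (λ p → ¬q₀ (Equivalence.to P⇔∀Q p fzero))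

φ-as-sum : ∀ N → φ N ≡ S N (λ x → ind (coprime? x N))
φ-as-sum N = length-filter (λ k → coprime? (toℕ k) N) {N} id (λ x → ind (coprime? x N)) (λ _ → refl)

φ-∏ : ∀ {r} (n : Fin r → ℕ) .{{_ : ∀ {i} → NonZero (n i)}} → PairwiseCoprime n →
      φ (∏ n) ≡ ∏ (λ i → φ (n i))
φ-∏ n n-pairwise = begin
  φ (∏ n)
    ≡⟨ φ-as-sum (∏ n) ⟩
  S (∏ n) (λ x → ind (coprime? x (∏ n)))
    ≡⟨ S-cong (∏ n) (λ x _ → ind-∀ (coprime? x (∏ n)) (λ i → coprime? (x % n i) (n i)) (unit⇔units x)) ⟩
  S (∏ n) (λ x → ∏ (λ i → ind (coprime? (x % n i) (n i))))
    ≡⟨ crt-reindex-∏ n n-pairwise (λ i y → ind (coprime? y (n i))) ⟩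
  ∏ (λ i → S (n i) (λ y → ind (coprime? y (n i))))
    ≡⟨ ∏-cong (λ i → φ-as-sum (n i)) ⟨
  ∏ (λ i → φ (n i))  ∎
  where
  open ≡-Reasoning
  unit⇔units : ∀ x → Coprime x (∏ n) ⇔ (∀ i → Coprime (x % n i) (n i))
  unit⇔units x = mk⇔ to from
    where
    to : Coprime x (∏ n) → ∀ i → Coprime (x % n i) (n i)
    to x⊥∏ i = coprime-% (sym (m%n%n≡m%n x (n i))) (coprime-divisorʳ x⊥∏ (∣∏ n i))
    from : (∀ i → Coprime (x % n i) (n i)) → Coprime x (∏ n)
    from x⊥n = coprime-∏ʳ x n (λ i → coprime-% (m%n%n≡m%n x (n i)) (x⊥n i))

-- Relative to I ⊆ K an index
-- lies in I, in K ∖ I, or outside K; this role fixes the residues (0 or 1)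
-- of the idempotents d_I, d_{K∖I}, d_K and the local shape of the fibre.

data Role : Set where
  inI inK∖I outK : Role

role : (i∈I i∈K : Bool) → Role
role true  _     = inI
role false true  = inK∖I
role false false = outK

∈I ∈K∖I ∈K : Role → Bool
∈I inI    = true
∈I inK∖I  = false
∈I outK   = false
∈K∖I inI   = false
∈K∖I inK∖I = true
∈K∖I outK  = false
∈K inI    = true
∈K inK∖I  = true
∈K outK   = false

∈I-role : ∀ a b → ∈I (role a b) ≡ a
∈I-role true  _     = refl
∈I-role false true  = refl
∈I-role false false = refl

∈K-role : ∀ a b → (a ≡ true → b ≡ true) → ∈K (role a b) ≡ b
∈K-role true  b     a⇒b = sym (a⇒b refl)
∈K-role false true  _   = refl
∈K-role false false _   = refl

∈K∖I-role : ∀ a b → ∈K∖I (role a b) ≡ (if a then false else b)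
∈K∖I-role true  _     = refl
∈K∖I-role false true  = refl
∈K∖I-role false false = refl

∉K⇒outK : ∀ ρ → ∈K ρ ≡ false → ρ ≡ outK
∉K⇒outK outK _ = refl

-- d_J ≡ 0 at the components indexed by J and ≡ 1 at all others
idemResidue : Bool → ℕ
idemResidue b = if b then 0 else 1

record IdempotentResidues (ρ : Role) (q : ℕ) .{{_ : NonZero q}} (dI dK∖I dK : ℕ) : Set where
  field
    dI≈   : dI % q ≡ idemResidue (∈I ρ) % q
    dK∖I≈ : dK∖I % q ≡ idemResidue (∈K∖I ρ) % q
    dK≈   : dK % q ≡ idemResidue (∈K ρ) % q
open IdempotentResidues

Local : Role → (q u y : ℕ) → .{{NonZero q}} → Set
Local inI   q u y = y % q ≡ 0 % q
Local inK∖I q u y = Coprime y q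
Local outK  q u y = y % q ≡ u % q

Local? : ∀ ρ q u y .{{_ : NonZero q}} → Dec (Local ρ q u y)
Local? inI   q u y = y % q ≟ 0 % q
Local? inK∖I q u y = coprime? y q
Local? outK  q u y = y % q ≟ u % q

Local-resp : ∀ ρ q {u x y} .{{_ : NonZero q}} → x % q ≡ y % q → Local ρ q u x → Local ρ q u y
Local-resp inI   q x≈y x≈0 = trans (sym x≈y) x≈0
Local-resp inK∖I q x≈y x⊥q = coprime-% x≈y x⊥q
Local-resp outK  q x≈y x≈u = trans (sym x≈y) x≈u

local-of-fibre : ∀ ρ q {u x w dI dK∖I dK} .{{_ : NonZero q}} → IdempotentResidues ρ q dI dK∖I dK →
                 Coprime w q → x % q ≡ (dI * w) % q → (dK∖I * x) % q ≡ (dK * u) % q → Local ρ q u x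
local-of-fibre inI   q res w⊥q x≈dIw _   = trans x≈dIw (%-*-by-0 q (dI≈ res))
local-of-fibre inK∖I q res w⊥q x≈dIw _   = coprime-% (sym (trans x≈dIw (%-*-by-1 q (dI≈ res)))) w⊥q
local-of-fibre outK  q res w⊥q _     eqn =
  trans (sym (%-*-by-1 q (dK∖I≈ res))) (trans eqn (%-*-by-1 q (dK≈ res)))

local-of-image : ∀ ρ q {u x v dI} .{{_ : NonZero q}} → dI % q ≡ idemResidue (∈I ρ) % q →
                 Coprime v q → (ρ ≡ outK → v % q ≡ u % q) → x % q ≡ (dI * v) % q → Local ρ q u x
local-of-image inI   q dI≈0 v⊥q _   x≈dIv = trans x≈dIv (%-*-by-0 q dI≈0)
local-of-image inK∖I q dI≈1 v⊥q _   x≈dIv = coprime-% (sym (trans x≈dIv (%-*-by-1 q dI≈1))) v⊥q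
local-of-image outK  q dI≈1 v⊥q v≈u x≈dIv = trans x≈dIv (trans (%-*-by-1 q dI≈1) (v≈u refl))

-- The residue a unit w must have for x ≡ d_I w to hold locally.
witnessResidue : Role → ℕ → ℕ
witnessResidue inI   x = 1
witnessResidue inK∖I x = x
witnessResidue outK  x = x

local-witness : ∀ ρ q {u x w dI} .{{_ : NonZero q}} → dI % q ≡ idemResidue (∈I ρ) % q →
                Coprime u q → Local ρ q u x → w % q ≡ witnessResidue ρ x % q →
                Coprime w q × x % q ≡ (dI * w) % q × (ρ ≡ outK → w % q ≡ u % q)
local-witness inI   q dI≈0 u⊥q x≈0 w≈1 =
  coprime-% (sym w≈1) (1-coprimeTo q) , trans x≈0 (sym (%-*-by-0 q dI≈0)) , λ ()
local-witness inK∖I q dI≈1 u⊥q x⊥q w≈x =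
  coprime-% (sym w≈x) x⊥q , sym (trans (%-*-by-1 q dI≈1) w≈x) , λ ()
local-witness outK  q dI≈1 u⊥q x≈u w≈x =
  coprime-% (sym (trans w≈x x≈u)) u⊥q , sym (trans (%-*-by-1 q dI≈1) w≈x) , λ _ → trans w≈x x≈u

local-fibre-equation : ∀ ρ q {u x dI dK∖I dK} .{{_ : NonZero q}} → IdempotentResidues ρ q dI dK∖I dK →
                       Local ρ q u x → (dK∖I * x) % q ≡ (dK * u) % q
local-fibre-equation inI   q res x≈0 =
  trans (%-*-by-1 q (dK∖I≈ res)) (trans x≈0 (sym (%-*-by-0 q (dK≈ res))))
local-fibre-equation inK∖I q res _   =
  trans (%-*-by-0 q (dK∖I≈ res)) (sym (%-*-by-0 q (dK≈ res)))
local-fibre-equation outK  q res x≈u =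
  trans (%-*-by-1 q (dK∖I≈ res)) (trans x≈u (sym (%-*-by-1 q (dK≈ res))))

local-count : ∀ ρ q u .{{_ : NonZero q}} →
              S q (λ y → ind (Local? ρ q u y)) * φ (if ∈I ρ then q else 1) ≡ φ (if ∈K ρ then q else 1)
local-count inI   q u = trans (cong (_* φ q) (count-residue q (0 % q) (m%n<n 0 q))) (+-identityʳ (φ q))
local-count inK∖I q u = trans (*-identityʳ _) (sym (φ-as-sum q))
local-count outK  q u = trans (*-identityʳ _) (count-residue q (u % q) (m%n<n u q))

lookup-─ : ∀ {r} (K I : Subset r) i → lookup (K ─ I) i ≡ (if lookup I i then false else lookup K i)
lookup-─ (_ ∷ K) (true  ∷ I) fzero    = refl
lookup-─ (_ ∷ K) (false ∷ I) fzero    = refl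
lookup-─ (_ ∷ K) (_     ∷ I) (fsuc i) = lookup-─ K I i

module PrimePowers {r} (p e : Fin r → ℕ) (fac : Factorisation p e) where

  q : Fin r → ℕ
  q i = p i ^ e i

  instance
    q-nonZero : ∀ {i} → NonZero (q i)
    q-nonZero {i} = m^n≢0 (p i) (e i) {{prime⇒nonZero (proj₁ fac i)}}

  q-pairwise : PairwiseCoprime q
  q-pairwise i j i≢j = coprime-^ (e i) (e j)
    (distinct-primes-coprime (proj₁ fac i) (proj₁ fac j) (i≢j ∘ proj₁ (proj₂ fac) i j))

  component : Subset r → Fin r → ℕ
  component J i = if lookup J i then q i else 1

  component-nonZero : ∀ J i → NonZero (component J i)
  component-nonZero J i with lookup J i
  ... | true  = q-nonZero
  ... | false = _

  component-pairwise : ∀ J → PairwiseCoprime (component J)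
  component-pairwise J i j i≢j with lookup J i | lookup J j
  ... | true  | true  = q-pairwise i j i≢j
  ... | true  | false = coprime-1ʳ (q i)
  ... | false | _     = 1-coprimeTo _

  φ-gJ : ∀ J → φ (gJ p e J) ≡ ∏ (λ i → φ (component J i))
  φ-gJ J = φ-∏ (component J) {{λ {i} → component-nonZero J i}} (component-pairwise J)

  Cong-gJ⇔ : ∀ J {a b} → Cong (gJ p e J) a b ⇔ (∀ i → lookup J i ≡ true → a % q i ≡ b % q i)
  Cong-gJ⇔ J {a} {b} = mk⇔ to from
    where
    to : Cong (gJ p e J) a b → ∀ i → lookup J i ≡ true → a % q i ≡ b % q i
    to a≡b i i∈J = Cong⇒%≡ (q i) a b (∣-trans (subst (_∣ gJ p e J) q-component (∣∏ (component J) i)) a≡b)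
      where
      q-component : component J i ≡ q i
      q-component rewrite i∈J = refl
    from : (∀ i → lookup J i ≡ true → a % q i ≡ b % q i) → Cong (gJ p e J) a b
    from a≈b = ∏∣ (component J) (component-pairwise J) local
      where
      local : ∀ i → component J i ∣ ∣ a - b ∣
      local i with lookup J i in i∈J
      ... | true  = %≡⇒Cong (q i) a b (a≈b i i∈J)
      ... | false = 1∣ _

  d-residue : ∀ {d} → IsIdempotentFamily p e d → ∀ J i → d J % q i ≡ idemResidue (lookup J i) % q i
  d-residue {d} idem J i with lookup J i in lookup≡
  ... | true  = Cong⇒%≡ (q i) (d J) 0 (proj₁ (proj₂ (idem J)) i (lookup⇒[]= i J lookup≡))
  ... | false = Cong⇒%≡ (q i) (d J) 1 (proj₂ (proj₂ (idem J)) i i∉J)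
    where
    i∉J : i ∉ J
    i∉J i∈J with () ← trans (sym ([]=⇒lookup i∈J)) lookup≡

-- Both the fibre and
-- the claimed set {d_I v : v ≡ u (mod g_{∁K})} coincide with the points whose
-- residue at every component has the local shape of its role.

module Fibres {r} (p e : Fin r → ℕ) (fac : Factorisation p e)
              (d : Subset r → ℕ) (idem : IsIdempotentFamily p e d)
              (I K : Subset r) (I⊆K : I ⊆ K)
              (u : Fin (modulus p e)) (u-unit : Coprime (toℕ u) (modulus p e)) where

  open PrimePowers p e fac

  m : ℕ
  m = modulus p e

  instance
    m-nonZero : NonZero m
    m-nonZero = ∏-nonZero q

  ρ : Fin r → Role
  ρ i = role (lookup I i) (lookup K i)

  ∈I-ρ : ∀ i → ∈I (ρ i) ≡ lookup I i
  ∈I-ρ i = ∈I-role (lookup I i) (lookup K i)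

  ∈K-ρ : ∀ i → ∈K (ρ i) ≡ lookup K i
  ∈K-ρ i = ∈K-role (lookup I i) (lookup K i) (λ i∈I → []=⇒lookup (I⊆K (lookup⇒[]= i I i∈I)))

  outK⇒∈∁K : ∀ i → ρ i ≡ outK → lookup (∁ K) i ≡ true
  outK⇒∈∁K i ρ≡outK = trans (lookup-map i not K) (cong not (trans (sym (∈K-ρ i)) (cong ∈K ρ≡outK)))

  ∈∁K⇒outK : ∀ i → lookup (∁ K) i ≡ true → ρ i ≡ outK
  ∈∁K⇒outK i i∈∁K = ∉K⇒outK (ρ i) (trans (∈K-ρ i) (not-true (trans (sym (lookup-map i not K)) i∈∁K)))
    where
    not-true : ∀ {b} → not b ≡ true → b ≡ false
    not-true {false} _ = refl

  residues : ∀ i → IdempotentResidues (ρ i) (q i) (d I) (d (K ─ I)) (d K)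
  residues i = record
    { dI≈   = subst (λ b → d I % q i ≡ idemResidue b % q i) (sym (∈I-ρ i)) (d-residue idem I i)
    ; dK∖I≈ = subst (λ b → d (K ─ I) % q i ≡ idemResidue b % q i)
                    (trans (lookup-─ K I i) (sym (∈K∖I-role (lookup I i) (lookup K i))))
                    (d-residue idem (K ─ I) i)
    ; dK≈   = subst (λ b → d K % q i ≡ idemResidue b % q i) (sym (∈K-ρ i)) (d-residue idem K i)
    }

  Locals : ℕ → Set
  Locals x = ∀ i → Local (ρ i) (q i) (toℕ u) x

  u-local-unit : ∀ i → Coprime (toℕ u) (q i)
  u-local-unit i = coprime-divisorʳ u-unit (∣∏ q i)

  Fibre : Fin m → Set
  Fibre = InFibre m (d I) (d (K ─ I)) (d K * toℕ u)

  fibre? : ∀ x → Dec (Fibre x)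
  fibre? = inFibre? m (d I) (d (K ─ I)) (d K * toℕ u)

  Preimage : ℕ → Set
  Preimage x = ∃ λ (v : Fin m) → Coprime (toℕ v) m × Cong (gJ p e (∁ K)) (toℕ v) (toℕ u) × Cong m x (d I * toℕ v)

  fibre⇒locals : ∀ {x} → Fibre x → Locals (toℕ x)
  fibre⇒locals ((w , w-unit , x≡dIw) , Hx≡dKu) i =
    local-of-fibre (ρ i) (q i) (residues i) (coprime-divisorʳ w-unit (∣∏ q i))
                   (Cong-∏⇒ q x≡dIw i) (Cong-∏⇒ q Hx≡dKu i)

  preimage⇒locals : ∀ {x} → Preimage x → Locals x
  preimage⇒locals (v , v-unit , v≡u , x≡dIv) i =
    local-of-image (ρ i) (q i) (dI≈ (residues i)) (coprime-divisorʳ v-unit (∣∏ q i))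
                   (Equivalence.to (Cong-gJ⇔ (∁ K)) v≡u i ∘ outK⇒∈∁K i) (Cong-∏⇒ q x≡dIv i)

  -- A unit w with the witness residues at every component (Chinese remainder theorem).
  locals⇒preimage : ∀ {x} → Locals x → Preimage x
  locals⇒preimage {x} x-locals = w , w-unit , w≡u , x≡dIw
    where
    solution = crt-exists-∏ q q-pairwise (λ i → witnessResidue (ρ i) x)
    y = proj₁ solution
    w : Fin m
    w = fromℕ< (m%n<n y m)
    w≈ : ∀ i → toℕ w % q i ≡ witnessResidue (ρ i) x % q i
    w≈ i rewrite toℕ-fromℕ< (m%n<n y m) = trans (m∣n⇒o%n%m≡o%m (q i) m y (∣∏ q i)) (proj₂ solution i)
    local : ∀ i → Coprime (toℕ w) (q i) × x % q i ≡ (d I * toℕ w) % q i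
                  × (ρ i ≡ outK → toℕ w % q i ≡ toℕ u % q i)
    local i = local-witness (ρ i) (q i) (dI≈ (residues i)) (u-local-unit i) (x-locals i) (w≈ i)
    w-unit : Coprime (toℕ w) m
    w-unit = coprime-∏ʳ (toℕ w) q (λ i → proj₁ (local i))
    w≡u : Cong (gJ p e (∁ K)) (toℕ w) (toℕ u)
    w≡u = Equivalence.from (Cong-gJ⇔ (∁ K)) (λ i i∈∁K → proj₂ (proj₂ (local i)) (∈∁K⇒outK i i∈∁K))
    x≡dIw : Cong m x (d I * toℕ w)
    x≡dIw = Cong-∏⇐ q q-pairwise (λ i → proj₁ (proj₂ (local i)))

  locals⇒fibre : ∀ {x} → Locals (toℕ x) → Fibre x
  locals⇒fibre x-locals with locals⇒preimage x-locals
  ... | w , w-unit , _ , x≡dIw =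
    (w , w-unit , x≡dIw) , Cong-∏⇐ q q-pairwise (λ i → local-fibre-equation (ρ i) (q i) (residues i) (x-locals i))

  fibre⇔preimage : ∀ x → Fibre x ⇔ Preimage (toℕ x)
  fibre⇔preimage x = mk⇔ (locals⇒preimage ∘ fibre⇒locals) (locals⇒fibre ∘ preimage⇒locals)

  localIndicator : Fin r → ℕ → ℕ
  localIndicator i y = ind (Local? (ρ i) (q i) (toℕ u) y)

  fibre-indicator : ∀ (x : Fin m) → ind (fibre? x) ≡ ∏ (λ i → localIndicator i (toℕ x % q i))
  fibre-indicator x = ind-∀ (fibre? x) (λ i → Local? (ρ i) (q i) (toℕ u) (toℕ x % q i)) (mk⇔ to from)
    where
    x≈x%q : ∀ i → toℕ x % q i ≡ (toℕ x % q i) % q i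
    x≈x%q i = sym (m%n%n≡m%n (toℕ x) (q i))
    to : Fibre x → ∀ i → Local (ρ i) (q i) (toℕ u) (toℕ x % q i)
    to x∈F i = Local-resp (ρ i) (q i) (x≈x%q i) (fibre⇒locals x∈F i)
    from : (∀ i → Local (ρ i) (q i) (toℕ u) (toℕ x % q i)) → Fibre x
    from x%q-locals = locals⇒fibre (λ i → Local-resp (ρ i) (q i) (sym (x≈x%q i)) (x%q-locals i))

  fibre-count : fibreSize m (d I) (d (K ─ I)) (d K * toℕ u) * φ (gJ p e I) ≡ φ (gJ p e K)
  fibre-count = begin
    fibreSize m (d I) (d (K ─ I)) (d K * toℕ u) * φ (gJ p e I)
      ≡⟨ cong₂ _*_ (length-filter fibre? {m} id _ fibre-indicator) (φ-gJ I) ⟩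
    S m (λ x → ∏ (λ i → localIndicator i (x % q i))) * ∏ (λ i → φ (component I i))
      ≡⟨ cong (_* ∏ (λ i → φ (component I i))) (crt-reindex-∏ q q-pairwise localIndicator) ⟩
    ∏ (λ i → S (q i) (localIndicator i)) * ∏ (λ i → φ (component I i))
      ≡⟨ ∏-distrib (λ i → S (q i) (localIndicator i)) (λ i → φ (component I i)) ⟨
    ∏ (λ i → S (q i) (localIndicator i) * φ (component I i))
      ≡⟨ ∏-cong component-count ⟩
    ∏ (λ i → φ (component K i))
      ≡⟨ φ-gJ K ⟨
    φ (gJ p e K)  ∎
    where
    open ≡-Reasoning
    component-count : ∀ i → S (q i) (localIndicator i) * φ (component I i) ≡ φ (component K i)
    component-count i =
      subst₂ (λ a b → S (q i) (localIndicator i) * φ (if a then q i else 1) ≡ φ (if b then q i else 1))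
             (∈I-ρ i) (∈K-ρ i) (local-count (ρ i) (q i) (toℕ u))

mainTheorem17 : ∀ {r} (p e : Fin r → ℕ) → Factorisation p e →
    (d : Subset r → ℕ) → IsIdempotentFamily p e d →
    (I K : Subset r) → I ⊆ K →
    (∀ (u : Fin (modulus p e)) → Coprime (toℕ u) (modulus p e) →
      (∀ (x : Fin (modulus p e)) →
        InFibre (modulus p e) (d I) (d (K ─ I)) (d K * toℕ u) x
        ⇔ (∃ λ (v : Fin (modulus p e)) → Coprime (toℕ v) (modulus p e)
             × Cong (gJ p e (∁ K)) (toℕ v) (toℕ u)
             × Cong (modulus p e) (toℕ x) (d I * toℕ v)))
      × (fibreSize (modulus p e) (d I) (d (K ─ I)) (d K * toℕ u) * φ (gJ p e I)
          ≡ φ (gJ p e K)))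
mainTheorem17 p e fac d idem I K I⊆K u u-unit = fibre⇔preimage , fibre-count
  where open Fibres p e fac d idem I K I⊆K u u-unit
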